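{- Let $T$ be a tree rooted in a vertex $r$ and $\tau$ a threshold function for $T$. For every vertex $u$ of $T$ and every non-negative integer $b\leq n(T_u)-1$ there is a set $Y\subseteq V(T_u)\setminus\{u\}$ with $|Y|=b$ such that simultaneously ${\rm dyn}(T_u-Y,\tau)=y_0(u,b)$ and ${\rm dyn}(T_u-Y,\tau^u)=y_1(u,b)$.
   Context: A threshold function for a graph $G$ is a function $\tau:U\to\mathbb{Z}\cup\{\infty\}$ whose domain $U$ contains $V(G)$. For $D\subseteq V(G)$, the hull $H_{(G,\tau)}(D)$ is the smallest $H\subseteq V(G)$ with $D\subseteq H$ and $u\in H$ for every vertex $u$ with $|H\cap N_G(u)|\geq\tau(u)$; $D$ is a dynamic monopoly if $H_{(G,\tau)}(D)=V(G)$; ${\rm dyn}(G,\tau)$ is the minimum order of a dynamic monopoly. For a vertex $u$, $\tau^u$ equals $\tau$ except $\tau^u(u)=\tau(u)-1$. $T_u$ is the subtree of $T$ induced by $u$ and its descendants, $n(T_u)$ its order. $y_0(u,b)=\max\{{\rm dyn}(T_u-Y,\tau):Y\subseteq V(T_u),|Y|=b,u\notin Y\}$ and $y_1(u,b)=\max\{{\rm dyn}(T_u-Y,\tau^u):Y\subseteq V(T_u),|Y|=b,u\notin Y\}$. -}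

module Defs where

open import Data.Nat using (ℕ; zero; suc; _≤_; _∸_)
open import Data.Integer as ℤ using (ℤ; +_)
open import Data.Bool using (Bool; true; false)
open import Data.Fin using (Fin)
open import Data.Fin.Subset using (Subset; _∈_; _∉_; _⊆_; _∩_; _─_; ∣_∣)
open import Data.Vec using (tabulate)
open import Data.List using (List; []; _∷_; _++_; [_]; length)
open import Data.List.Relation.Unary.Linked using (Linked)
open import Data.List.Relation.Unary.Unique.Propositional using (Unique)
open import Data.Product using (Σ; ∃; _×_; _,_)
open import Data.Empty using (⊥)
open import Relation.Nullary using (¬_)
open import Relation.Binary.PropositionalEquality using (_≡_; _≢_)

record Graph (n : ℕ) : Set where
  field
    adj   : Fin n → Fin n → Bool
    sym   : ∀ x y → adj x y ≡ adj y x
    irrefl : ∀ x → adj x x ≡ false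

module _ {n : ℕ} (G : Graph n) where
  open Graph G

  Edge : Fin n → Fin n → Set
  Edge x y = adj x y ≡ true

  N : Fin n → Subset n
  N u = tabulate (adj u)

  data Walk : Fin n → Fin n → Set where
    here : ∀ {x} → Walk x x
    step : ∀ {x z y} → Edge x z → Walk z y → Walk x y

  data Visits (u : Fin n) : ∀ {x y} → Walk x y → Set where
    vhere : ∀ {y} {w : Walk u y} → Visits u w
    vthere : ∀ {x z y} {e : Edge x z} {w : Walk z y} → Visits u w → Visits u (step e w)

  Connected : Set
  Connected = ∀ x y → Walk x y

  -- a cycle: distinct vertices v ∷ vs (at least 3), consecutive ones adjacent,
  -- and the last one adjacent to v
  IsCycle : Fin n → List (Fin n) → Set
  IsCycle v vs = Unique (v ∷ vs) × (2 ≤ length vs) × Linked Edge (v ∷ vs ++ [ v ])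

  Acyclic : Set
  Acyclic = ∀ v vs → ¬ IsCycle v vs

  IsTree : Set
  IsTree = Connected × Acyclic

  -- In the tree rooted at r, v is a descendant of u (v ∈ V(T_u)) iff u lies on
  -- the (unique) r–v path, i.e. every r–v walk visits u.
  Desc : (r u v : Fin n) → Set
  Desc r u v = ∀ (w : Walk r v) → Visits u w

data ℤ∞ : Set where
  fin : ℤ → ℤ∞
  ∞   : ℤ∞

_≥∞_ : ℕ → ℤ∞ → Set
k ≥∞ fin z = z ℤ.≤ + k
k ≥∞ ∞ = ⊥

Threshold : ℕ → Set
Threshold n = Fin n → ℤ∞

dec∞ : ℤ∞ → ℤ∞
dec∞ (fin z) = fin (z ℤ.- + 1)
dec∞ ∞ = ∞

module _ {n : ℕ} (G : Graph n) where
  open Data.Fin using (_≟_)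
  open import Relation.Nullary using (yes; no)

  lower : Threshold n → Fin n → Threshold n
  lower τ u v with v ≟ u
  ... | yes _ = dec∞ (τ v)
  ... | no _ = τ v

  -- Everything below concerns the induced subgraph G[S]; its neighbourhoods
  -- are N_G(v) ∩ S, and for H ⊆ S we have H ∩ N_{G[S]}(v) = H ∩ N_G(v).
  Closed : Threshold n → (S D H : Subset n) → Set
  Closed τ S D H = D ⊆ H × H ⊆ S ×
    (∀ v → v ∈ S → ∣ H ∩ N G v ∣ ≥∞ τ v → v ∈ H)

  IsHull : Threshold n → (S D H : Subset n) → Set
  IsHull τ S D H = Closed τ S D H × (∀ H′ → Closed τ S D H′ → H ⊆ H′)

  DynMon : Threshold n → (S D : Subset n) → Set
  DynMon τ S D = D ⊆ S × IsHull τ S D S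

  IsDyn : Threshold n → Subset n → ℕ → Set
  IsDyn τ S k = (Σ (Subset n) λ D → DynMon τ S D × ∣ D ∣ ≡ k)
              × (∀ D → DynMon τ S D → k ≤ ∣ D ∣)

  Admissible : (Su : Subset n) (u : Fin n) (b : ℕ) (Y : Subset n) → Set
  Admissible Su u b Y = Y ⊆ Su × ∣ Y ∣ ≡ b × u ∉ Y

  -- k = max { dyn(T_u − Y, τ) : Y admissible }
  -- (use τ for y₀(u,b) and lower τ u for y₁(u,b))
  IsMaxDyn : Threshold n → (Su : Subset n) (u : Fin n) (b k : ℕ) → Set
  IsMaxDyn τ Su u b k =
    (Σ (Subset n) λ Y → Admissible Su u b Y × IsDyn τ (Su ─ Y) k)
    × (∀ Y k′ → Admissible Su u b Y → IsDyn τ (Su ─ Y) k′ → k′ ≤ k)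

-- Only the threshold of u differs between τ and τ^u, so for every S ∋ u
--   dyn(S, τ^u) ≤ dyn(S, τ) ≤ dyn(S, τ^u) + 1,
-- the upper bound because adding u to a dynamic monopoly for τ^u gives one for τ.
-- Hence f(Y) = dyn(T_u − Y, τ) and g(Y) = dyn(T_u − Y, τ^u) satisfy g ≤ f ≤ g + 1
-- on the admissible Y. If max f ≤ max g, a maximiser of g also maximises f;
-- otherwise max g < max f ≤ g(Y₀) + 1 for a maximiser Y₀ of f, which therefore
-- maximises g.

module Submission where

open import Defs
open import Data.Nat using (ℕ; _≤_; _∸_)
open import Data.Fin using (Fin)
open import Data.Fin.Subset using (Subset; _∈_; _─_; ∣_∣)
open import Data.Product using (Σ; _×_)
open import Function.Bundles using (_⇔_)

open import Level using (Level; _⊔_)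
open import Data.Nat as ℕ using (suc; _<_; s≤s; _≤?_)
open import Data.Nat.Properties
  using (module ≤-Reasoning; ≤-antisym; ≤-pred; ≮⇒≥; ≰⇒>; anyUpTo?)
open import Data.Nat.Induction using (<-rec)
open import Data.Fin as F using (_≟_)
open import Data.Fin.Subset using (_⊆_; _∩_; _∪_; ⁅_⁆; inside; outside)
open import Data.Fin.Subset.Properties
  using (_⊆?_; _∈?_; anySubset?; ∣p∣≤∣x∷p∣; ∪-identityʳ; p⊆p∪q; q⊆p∪q; x∈p∪q⁻; x∈⁅x⁆;
         x∈⁅y⁆⇒x≡y; x∈p∧x∉q⇒x∈p─q)
open import Data.Fin.Properties using (all?)
open import Data.Vec using (_∷_)
open import Data.Product using (_,_; ∃; proj₁; proj₂)
open import Data.Sum using (inj₁; inj₂)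
open import Data.Integer as ℤ using (+_)
open import Data.Integer.Properties using (i≤j⇒i-k≤j)
open import Function.Bundles using (module Equivalence)
open import Relation.Nullary using (Dec; yes; no; contradiction)
open import Relation.Nullary.Decidable using (_×-dec_; _→-dec_; ¬?)
open import Relation.Unary using (Pred; Decidable)
open import Relation.Binary.PropositionalEquality using (_≡_; refl; sym; subst; cong)

∣p∪⁅x⁆∣≤1+∣p∣ : ∀ {n} (p : Subset n) (x : Fin n) → ∣ p ∪ ⁅ x ⁆ ∣ ≤ suc ∣ p ∣
∣p∪⁅x⁆∣≤1+∣p∣ (outside ∷ p) F.zero    rewrite ∪-identityʳ p = s≤s (∣p∣≤∣x∷p∣ outside p)
∣p∪⁅x⁆∣≤1+∣p∣ (inside ∷ p)  F.zero    rewrite ∪-identityʳ p = s≤s (∣p∣≤∣x∷p∣ inside p)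
∣p∪⁅x⁆∣≤1+∣p∣ (outside ∷ p) (F.suc x) = ∣p∪⁅x⁆∣≤1+∣p∣ p x
∣p∪⁅x⁆∣≤1+∣p∣ (inside ∷ p)  (F.suc x) = s≤s (∣p∪⁅x⁆∣≤1+∣p∣ p x)

Least : ∀ {ℓ} → Pred ℕ ℓ → ℕ → Set ℓ
Least P k = P k × (∀ {j} → P j → k ≤ j)

module _ {ℓ : Level} {P : Pred ℕ ℓ} (P? : Decidable P) where

  least : ∀ {m} → P m → ∃ (Least P)
  least {m} = <-rec (λ m → P m → ∃ (Least P)) search m
    where
    search : ∀ m → (∀ {i} → i < m → P i → ∃ (Least P)) → P m → ∃ (Least P)
    search m below pm with anyUpTo? P? m
    ... | yes (i , i<m , pi) = below i<m pi
    ... | no none            = m , pm , λ {j} pj → ≮⇒≥ (λ j<m → none (j , j<m , pj))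

_≥∞?_ : ∀ k t → Dec (k ≥∞ t)
k ≥∞? fin z = z ℤ.≤? + k
k ≥∞? ∞     = no λ ()

≥∞-dec∞ : ∀ {k} t → k ≥∞ t → k ≥∞ dec∞ t
≥∞-dec∞ (fin z) z≤k = i≤j⇒i-k≤j (+ 1) z≤k

module _ {a ℓ} {A : Set a} (P : Pred A ℓ) where

  Maximum : (A → ℕ) → ℕ → Set (a ⊔ ℓ)
  Maximum f m = (∃ λ x → P x × f x ≡ m) × (∀ {x} → P x → f x ≤ m)

  common-maximiser : ∀ {f g m₀ m₁} → (∀ {x} → P x → g x ≤ f x) → (∀ {x} → P x → f x ≤ suc (g x))
    → Maximum f m₀ → Maximum g m₁ → ∃ λ x → P x × f x ≡ m₀ × g x ≡ m₁
  common-maximiser {f} {g} {m₀} {m₁} g≤f f≤1+g ((x₀ , Px₀ , fx₀≡m₀) , f≤m₀) ((x₁ , Px₁ , gx₁≡m₁) , g≤m₁)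
    with m₀ ≤? m₁
  ... | yes m₀≤m₁ = x₁ , Px₁ , ≤-antisym (f≤m₀ Px₁) m₀≤fx₁ , gx₁≡m₁
    where
    m₀≤fx₁ : m₀ ≤ f x₁
    m₀≤fx₁ = begin m₀ ≤⟨ m₀≤m₁ ⟩ m₁ ≡⟨ sym gx₁≡m₁ ⟩ g x₁ ≤⟨ g≤f Px₁ ⟩ f x₁ ∎
      where open ≤-Reasoning
  ... | no m₀≰m₁ = x₀ , Px₀ , fx₀≡m₀ , ≤-antisym (g≤m₁ Px₀) (≤-pred m₁<1+gx₀)
    where
    m₁<1+gx₀ : m₁ < suc (g x₀)
    m₁<1+gx₀ = begin-strict m₁ <⟨ ≰⇒> m₀≰m₁ ⟩ m₀ ≡⟨ sym fx₀≡m₀ ⟩ f x₀ ≤⟨ f≤1+g Px₀ ⟩ suc (g x₀) ∎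
      where open ≤-Reasoning

_⊑_ : ∀ {n} → Threshold n → Threshold n → Set
τ′ ⊑ τ = ∀ v {k} → k ≥∞ τ v → k ≥∞ τ′ v

module _ {n : ℕ} (G : Graph n) where

  closed? : ∀ τ S D H → Dec (Closed G τ S D H)
  closed? τ S D H = (D ⊆? H) ×-dec (H ⊆? S) ×-dec
    all? (λ v → (v ∈? S) →-dec (∣ H ∩ N G v ∣ ≥∞? τ v) →-dec (v ∈? H))

  dynMon? : ∀ τ S D → Dec (DynMon G τ S D)
  dynMon? τ S D with anySubset? (λ H → closed? τ S D H ×-dec ¬? (S ⊆? H))
  ... | yes (H , closed , S⊈H) = no λ (_ , _ , S⊆closed) → S⊈H (S⊆closed H closed)
  ... | no none = (D ⊆? S) ×-dec closed? τ S D S ×-dec yes S⊆closed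
    where
    S⊆closed : ∀ H → Closed G τ S D H → S ⊆ H
    S⊆closed H closed with S ⊆? H
    ... | yes S⊆H = S⊆H
    ... | no S⊈H  = contradiction (H , closed , S⊈H) none

  closed-whole : ∀ {τ S D} → D ⊆ S → Closed G τ S D S
  closed-whole D⊆S = D⊆S , (λ v∈S → v∈S) , λ _ v∈S _ → v∈S

  dynMon-self : ∀ τ S → DynMon G τ S S
  dynMon-self τ S = (λ v∈S → v∈S) , closed-whole (λ v∈S → v∈S) , λ _ → proj₁

  dyn-exists : ∀ τ S → ∃ (IsDyn G τ S)
  dyn-exists τ S with least (λ k → anySubset? λ D → dynMon? τ S D ×-dec (∣ D ∣ ℕ.≟ k))
                            (S , dynMon-self τ S , refl)
  ... | k , monopoly , minimum = k , monopoly , λ D dm → minimum (D , dm , refl)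

  dyn : Threshold n → Subset n → ℕ
  dyn τ S = proj₁ (dyn-exists τ S)

  dyn-isDyn : ∀ τ S → IsDyn G τ S (dyn τ S)
  dyn-isDyn τ S = proj₂ (dyn-exists τ S)

  isDyn-unique : ∀ {τ S k k′} → IsDyn G τ S k → IsDyn G τ S k′ → k ≡ k′
  isDyn-unique {k = k} {k′} ((D , dm , ∣D∣≡k) , minimum) ((D′ , dm′ , ∣D′∣≡k′) , minimum′) =
    ≤-antisym (subst (k ≤_) ∣D′∣≡k′ (minimum D′ dm′)) (subst (k′ ≤_) ∣D∣≡k (minimum′ D dm))

  isDyn⇒dyn≡ : ∀ {τ S k} → IsDyn G τ S k → dyn τ S ≡ k
  isDyn⇒dyn≡ {τ} {S} = isDyn-unique (dyn-isDyn τ S)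

  dyn≡⇒isDyn : ∀ {τ S k} → dyn τ S ≡ k → IsDyn G τ S k
  dyn≡⇒isDyn {τ} {S} refl = dyn-isDyn τ S

  lower-⊑ : ∀ τ u → lower G τ u ⊑ τ
  lower-⊑ τ u v with v ≟ u
  ... | yes _ = ≥∞-dec∞ (τ v)
  ... | no _  = λ k≥τv → k≥τv

  dynMon-⊑ : ∀ {τ′ τ S D} → τ′ ⊑ τ → DynMon G τ S D → DynMon G τ′ S D
  dynMon-⊑ τ′⊑τ (D⊆S , _ , S⊆closed) = D⊆S , closed-whole D⊆S ,
    λ H (D⊆H , H⊆S , H-closed) → S⊆closed H (D⊆H , H⊆S , λ v v∈S k≥τv → H-closed v v∈S (τ′⊑τ v k≥τv))

  dyn-⊑ : ∀ {τ′ τ} S → τ′ ⊑ τ → dyn τ′ S ≤ dyn τ S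
  dyn-⊑ {τ′} {τ} S τ′⊑τ with dyn-isDyn τ S
  ... | (D , dm , ∣D∣≡dyn) , _ = subst (dyn τ′ S ≤_) ∣D∣≡dyn (proj₂ (dyn-isDyn τ′ S) D (dynMon-⊑ τ′⊑τ dm))

  dynMon-lower : ∀ {τ u S D} → u ∈ S → DynMon G (lower G τ u) S D → DynMon G τ S (D ∪ ⁅ u ⁆)
  dynMon-lower {τ} {u} {S} {D} u∈S (D⊆S , _ , S⊆closed) = D∪u⊆S , closed-whole D∪u⊆S , S⊆closed′
    where
    D∪u⊆S : D ∪ ⁅ u ⁆ ⊆ S
    D∪u⊆S v∈D∪u with x∈p∪q⁻ D ⁅ u ⁆ v∈D∪u
    ... | inj₁ v∈D = D⊆S v∈D
    ... | inj₂ v∈u rewrite x∈⁅y⁆⇒x≡y u v∈u = u∈S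
    S⊆closed′ : ∀ H → Closed G τ S (D ∪ ⁅ u ⁆) H → S ⊆ H
    S⊆closed′ H (D∪u⊆H , H⊆S , H-closed) =
      S⊆closed H ((λ v∈D → D∪u⊆H (p⊆p∪q ⁅ u ⁆ v∈D)) , H⊆S , H-closed′)
      where
      H-closed′ : ∀ v → v ∈ S → ∣ H ∩ N G v ∣ ≥∞ lower G τ u v → v ∈ H
      H-closed′ v v∈S with v ≟ u
      ... | yes refl = λ _ → D∪u⊆H (q⊆p∪q D ⁅ u ⁆ (x∈⁅x⁆ u))
      ... | no _     = H-closed v v∈S

  dyn≤1+dyn-lower : ∀ {τ u} S → u ∈ S → dyn τ S ≤ suc (dyn (lower G τ u) S)
  dyn≤1+dyn-lower {τ} {u} S u∈S with dyn-isDyn (lower G τ u) S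
  ... | (D , dm , ∣D∣≡dyn) , _ = begin
    dyn τ S                  ≤⟨ proj₂ (dyn-isDyn τ S) (D ∪ ⁅ u ⁆) (dynMon-lower u∈S dm) ⟩
    ∣ D ∪ ⁅ u ⁆ ∣            ≤⟨ ∣p∪⁅x⁆∣≤1+∣p∣ D u ⟩
    suc ∣ D ∣                ≡⟨ cong suc ∣D∣≡dyn ⟩
    suc (dyn (lower G τ u) S) ∎
    where open ≤-Reasoning

  isMaxDyn⇒Maximum : ∀ {τ Su u b k} → IsMaxDyn G τ Su u b k
    → Maximum (Admissible G Su u b) (λ Y → dyn τ (Su ─ Y)) k
  isMaxDyn⇒Maximum ((Y , adm , isDyn) , maximal) =
    (Y , adm , isDyn⇒dyn≡ isDyn) , λ adm′ → maximal _ _ adm′ (dyn-isDyn _ _)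

visits-end : ∀ {n} (G : Graph n) {x u} (w : Walk G x u) → Visits G u w
visits-end G here       = vhere
visits-end G (step _ w) = vthere (visits-end G w)

corollary11 : ∀ {n : ℕ} (T : Graph n) → IsTree T → (r : Fin n) (τ : Threshold n)
    (u : Fin n) (Su : Subset n) → (∀ v → (v ∈ Su) ⇔ Desc T r u v)
    → (b : ℕ) → b ≤ ∣ Su ∣ ∸ 1
    → (y₀ y₁ : ℕ) → IsMaxDyn T τ Su u b y₀ → IsMaxDyn T (lower T τ u) Su u b y₁
    → Σ (Subset n) λ Y → Admissible T Su u b Y
        × IsDyn T τ (Su ─ Y) y₀ × IsDyn T (lower T τ u) (Su ─ Y) y₁
corollary11 T _ r τ u Su Su⇔desc b _ y₀ y₁ max₀ max₁
  with common-maximiser (Admissible T Su u b) lower≤ ≤1+lower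
         (isMaxDyn⇒Maximum T max₀) (isMaxDyn⇒Maximum T max₁)
  where
  u∈Su : u ∈ Su
  u∈Su = Equivalence.from (Su⇔desc u) (visits-end T)
  lower≤ : ∀ {Y} → Admissible T Su u b Y → dyn T (lower T τ u) (Su ─ Y) ≤ dyn T τ (Su ─ Y)
  lower≤ {Y} _ = dyn-⊑ T (Su ─ Y) (lower-⊑ T τ u)
  ≤1+lower : ∀ {Y} → Admissible T Su u b Y → dyn T τ (Su ─ Y) ≤ suc (dyn T (lower T τ u) (Su ─ Y))
  ≤1+lower {Y} (_ , _ , u∉Y) = dyn≤1+dyn-lower T (Su ─ Y) (x∈p∧x∉q⇒x∈p─q u∈Su u∉Y)
... | Y , adm , dyn≡y₀ , dyn≡y₁ = Y , adm , dyn≡⇒isDyn T dyn≡y₀ , dyn≡⇒isDyn T dyn≡y₁
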